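{- Let $M$ be a binary matroid on ground set $V$, let $Z$ be a basis of $M$, and let $G$ be a graph on vertex set $V$ with $\mathcal{M}_G=M*Z$ (a fundamental graph of $M$). Then the column matroid over $\mathrm{GF}(2)$ of the adjacency matrix of $G+V$ equals the bicycle matroid of $M$.
   Context: Graphs on $V$ (loops allowed, no multiple edges) are identified with their adjacency matrices, symmetric $V\times V$-matrices over $\mathrm{GF}(2)$ (a diagonal entry is $1$ iff the vertex has a loop). $G+V$ is obtained from $G$ by complementing the loop status of every vertex (adding $1$ to every diagonal entry). For a $V\times V$-matrix $A$, $\mathcal{M}_A=(V,\{X\subseteq V: A[X]\text{ nonsingular}\})$ with $A[\emptyset]$ nonsingular by convention, and $\mathcal{M}_G=\mathcal{M}_{A(G)}$. The matroid $M$ is identified with the set system of its bases; $M*Z=(V,\{X\triangle Z: X\text{ a basis of }M\})$. The cycle space $\mathcal{CS}_M\subseteq\mathrm{GF}(2)^V$ is spanned by the incidence vectors of the circuits of $M$, and $\mathcal{CS}_M^\perp$ is its orthogonal complement under $\langle u,v\rangle=\sum_x u(x)v(x)$. The bicycle matroid of $M$ is the binary matroid on $V$ whose cycle space is $\mathcal{CS}_M\cap\mathcal{CS}_M^\perp$. -}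

module Defs where

open import Data.Nat using (ℕ; zero; suc)
open import Data.Fin using (Fin; zero; suc)
open import Data.Bool using (Bool; true; false; _xor_; _∧_; not)
open import Data.Product using (Σ; ∃; _×_; _,_)
open import Relation.Binary.PropositionalEquality using (_≡_)
open import Relation.Nullary using (¬_)
open import Function.Bundles using (_⇔_)

-- Ground set V = Fin n.  GF(2) = Bool (xor = +, ∧ = ·).
-- Vectors in GF(2)^V, equivalently subsets of V (incidence vectors).
Vect : ℕ → Set
Vect n = Fin n → Bool

Subset : ℕ → Set
Subset n = Vect n

Matrix : ℕ → ℕ → Set
Matrix m n = Fin m → Fin n → Bool

Σ₂ : ∀ {n} → (Fin n → Bool) → Bool
Σ₂ {zero}  f = false
Σ₂ {suc n} f = f zero xor Σ₂ (λ i → f (suc i))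

_·v_ : ∀ {m n} → Matrix m n → Vect n → Vect m
(B ·v c) i = Σ₂ (λ j → B i j ∧ c j)

⟨_,_⟩ : ∀ {n} → Vect n → Vect n → Bool
⟨ u , v ⟩ = Σ₂ (λ x → u x ∧ v x)

SupportedOn : ∀ {n} → Vect n → Subset n → Set
SupportedOn c X = ∀ j → X j ≡ false → c j ≡ false

IsZero : ∀ {n} → Vect n → Set
IsZero c = ∀ j → c j ≡ false

-- the principal submatrix A[X] is nonsingular: it has trivial kernel
-- (A[∅] is nonsingular, automatically).
Nonsingular[_] : ∀ {n} → Matrix n n → Subset n → Set
Nonsingular[ A ] X =
  ∀ c → SupportedOn c X → (∀ i → X i ≡ true → (A ·v c) i ≡ false) → IsZero c

-- Set systems on V; a matroid is identified with its set of bases.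
SetSystem : ℕ → Set₁
SetSystem n = Subset n → Set

𝓜 : ∀ {n} → Matrix n n → SetSystem n
𝓜 A X = Nonsingular[ A ] X

-- M * Z = (V, {X Δ Z : X basis of M}); since Δ Z is an involution,
-- Y ∈ M * Z  iff  Y Δ Z ∈ M.
_*_ : ∀ {n} → SetSystem n → Subset n → SetSystem n
(M * Z) Y = M (λ x → Y x xor Z x)

ColIndependent : ∀ {m n} → Matrix m n → Subset n → Set
ColIndependent B X = ∀ c → SupportedOn c X → IsZero (B ·v c) → IsZero c

ColSpanning : ∀ {m n} → Matrix m n → Subset n → Set
ColSpanning B X = ∀ j → Σ _ λ c → SupportedOn c X × (∀ i → (B ·v c) i ≡ B i j)

ColumnMatroid : ∀ {m n} → Matrix m n → SetSystem n
ColumnMatroid B X = ColIndependent B X × ColSpanning B X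

_≋_ : ∀ {n} → SetSystem n → SetSystem n → Set
M ≋ N = ∀ X → M X ⇔ N X

IsBinaryMatroid : ∀ {n} → SetSystem n → Set
IsBinaryMatroid {n} M = Σ ℕ λ m → Σ (Matrix m n) λ B → M ≋ ColumnMatroid B

_⊆_ : ∀ {n} → Subset n → Subset n → Set
X ⊆ Y = ∀ x → X x ≡ true → Y x ≡ true

Independent : ∀ {n} → SetSystem n → Subset n → Set
Independent M X = Σ _ λ B → M B × X ⊆ B

Dependent : ∀ {n} → SetSystem n → Subset n → Set
Dependent M X = ¬ Independent M X

_⊊_ : ∀ {n} → Subset n → Subset n → Set
X ⊊ Y = X ⊆ Y × ∃ λ x → Y x ≡ true × X x ≡ false

Circuit : ∀ {n} → SetSystem n → Subset n → Set
Circuit M C = Dependent M C × (∀ D → D ⊊ C → Independent M D)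

-- GF(2)-span of a family of vectors (closed under pointwise equality)
data Span {n} (P : Vect n → Set) : Vect n → Set where
  span-zero : ∀ {w} → IsZero w → Span P w
  span-add  : ∀ {v C w} → P C → Span P v →
              (∀ i → w i ≡ (v i xor C i)) → Span P w

CS : ∀ {n} → SetSystem n → Vect n → Set
CS M = Span (Circuit M)

CS⊥ : ∀ {n} → SetSystem n → Vect n → Set
CS⊥ M v = ∀ u → CS M u → ⟨ u , v ⟩ ≡ false

IsBicycleMatroidOf : ∀ {n} → SetSystem n → SetSystem n → Set
IsBicycleMatroidOf M N =
  IsBinaryMatroid N × (∀ v → CS N v ⇔ (CS M v × CS⊥ M v))

-- Graphs on V (loops allowed): symmetric matrices over GF(2)
record Graph (n : ℕ) : Set where
  field
    adj : Matrix n n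
    sym : ∀ x y → adj x y ≡ adj y x
open Graph public

-- A(G + V): complement every diagonal entry
adj+V : ∀ {n} → Graph n → Matrix n n
adj+V {n} G x y with x Data.Fin.≟ y
... | Relation.Nullary.yes _ = not (adj G x y)
... | Relation.Nullary.no _  = adj G x y

𝓜G : ∀ {n} → Graph n → SetSystem n
𝓜G G = 𝓜 (adj G)

-- Represent M by a GF(2)-matrix B.  The cycle space of any column matroid is the
-- kernel of its matrix (cycle-space-is-kernel: circuits are kernel vectors, and the
-- fundamental circuits of a basis span the kernel), so the claim becomes
-- ker A(G + V) = ker B ∩ (ker B)^⊥.  Comparing the principal submatrices of A(G) on
-- {v} and {a, b} with the bases {v} Δ Z and {a, b} Δ Z shows that G is loopless,
-- has no edges inside Z or outside Z, and joins z ∈ Z to w ∉ Z exactly when z occurs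
-- in the fundamental circuit of w (exchange property).  Hence A′ = A(G + V) is
-- symmetric, its columns outside Z are the fundamental circuits, and its rows in Z
-- are unit vectors on Z; from this ker B = {x : (A′ x)_i = 0 for all i ∈ Z}, and
-- symmetry of A′ turns the remaining rows into the orthogonality condition.
module Submission where

open import Data.Nat using (ℕ)
open import Data.Fin using (Fin; zero; suc; _≟_)
open import Data.Fin.Properties using (all?; any?; suc-injective)
open import Data.Fin.Subset.Properties using (anySubset?)
open import Data.Vec using (lookup; tabulate)
open import Data.Vec.Properties using (lookup∘tabulate)
open import Data.Bool using (Bool; true; false; _xor_; _∧_; _∨_; not)
import Data.Bool.Properties as Bool
open import Data.Bool.Properties
  using (xor-∧-commutativeRing; xor-same; xor-identityʳ; ∧-comm; ∧-assoc;
         ∧-zeroʳ; ∧-identityʳ; ∧-distribˡ-xor; ∨-zeroʳ)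
open import Algebra.Bundles using (CommutativeRing)
open import Algebra.Properties.CommutativeSemigroup
  (CommutativeRing.+-commutativeSemigroup xor-∧-commutativeRing) using (interchange)
open import Data.Product using (Σ; ∃; _×_; _,_; proj₁; proj₂)
open import Data.Sum using (_⊎_; inj₁; inj₂)
open import Data.List using (List; []; _∷_; allFin)
open import Data.List.Membership.Propositional using (_∈_)
open import Data.List.Membership.Propositional.Properties using (∈-allFin)
open import Data.List.Relation.Unary.Any using (here; there)
open import Function using (_∘_)
open import Function.Bundles using (_⇔_; mk⇔; Equivalence)
open import Relation.Binary.PropositionalEquality
open import Relation.Nullary using (¬_; Dec; yes; no; does; contradiction)
open import Relation.Nullary.Decidable using (dec-true; dec-false; map′; _×-dec_; _→-dec_)
open import Defs hiding (sym)

open Equivalence using (to; from)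
import Function.Properties.Equivalence as ⇔

private
  variable
    m n : ℕ

clash : {A : Set} {b : Bool} → b ≡ true → b ≡ false → A
clash refl ()

xor≡false⇒≡ : ∀ {a b} → (a xor b) ≡ false → a ≡ b
xor≡false⇒≡ {true}  {true}  _ = refl
xor≡false⇒≡ {false} {false} _ = refl

xor-interchange : ∀ a b c d → ((a xor b) xor (c xor d)) ≡ ((a xor c) xor (b xor d))
xor-interchange = interchange

bool-ext : ∀ {a b} → (a ≡ true ⇔ b ≡ true) → a ≡ b
bool-ext {true}           a⇔b = sym (to a⇔b refl)
bool-ext {false} {false}  a⇔b = refl
bool-ext {false} {true}   a⇔b = from a⇔b refl

-- Vector addition over GF(2); on incidence vectors it is symmetric difference.
_⊕_ : Vect n → Vect n → Vect n
(u ⊕ v) i = u i xor v i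

∁ : Subset n → Subset n
∁ X i = not (X i)

_↾_ : Vect n → Subset n → Vect n
(x ↾ X) i = x i ∧ X i

↾-supported : (X : Subset n) (x : Vect n) → SupportedOn (x ↾ X) X
↾-supported X x j Xj = trans (cong (x j ∧_) Xj) (∧-zeroʳ (x j))

↾-split : (X : Subset n) (x : Vect n) → x ≗ (x ↾ X) ⊕ (x ↾ ∁ X)
↾-split X x j with X j
... | true  = sym (trans (cong₂ _xor_ (∧-identityʳ (x j)) (∧-zeroʳ (x j)))
                         (xor-identityʳ (x j)))
... | false = sym (cong₂ _xor_ (∧-zeroʳ (x j)) (∧-identityʳ (x j)))

↾∁-true : (X : Subset n) {x : Vect n} {j : Fin n} → (x ↾ ∁ X) j ≡ true → X j ≡ false
↾∁-true X {x} {j} xj with X j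
... | false = refl
... | true  = clash xj (∧-zeroʳ (x j))

δ : Fin n → Vect n
δ j k = does (k ≟ j)

δ-diag : (j : Fin n) → δ j j ≡ true
δ-diag j = dec-true (j ≟ j) refl

δ-off : (j k : Fin n) → k ≢ j → δ j k ≡ false
δ-off j k = dec-false (k ≟ j)

-- Case split on equality of indices that, unlike a `with` on _≟_, does not
-- rewrite the unit vectors occurring in the goal.
fin-cases : (i j : Fin n) → i ≡ j ⊎ i ≢ j
fin-cases i j with i ≟ j
... | yes i≡j = inj₁ i≡j
... | no i≢j  = inj₂ i≢j

pair : Fin n → Fin n → Subset n
pair a b i = δ a i ∨ δ b i

pair-fst : (a b : Fin n) → pair a b a ≡ true
pair-fst a b rewrite δ-diag a = refl

pair-snd : (a b : Fin n) → pair a b b ≡ true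
pair-snd a b rewrite δ-diag b = ∨-zeroʳ (δ a b)

pair-off : (a b i : Fin n) → i ≢ a → i ≢ b → pair a b i ≡ false
pair-off a b i i≢a i≢b rewrite δ-off a i i≢a | δ-off b i i≢b = refl

δ-⊆ : {X : Subset n} (j : Fin n) → X j ≡ true → δ j ⊆ X
δ-⊆ j Xj i δji with fin-cases i j
... | inj₁ refl = Xj
... | inj₂ i≢j  = clash δji (δ-off j i i≢j)

pair-⊆ : {X : Subset n} {a b : Fin n} → X a ≡ true → X b ≡ true → pair a b ⊆ X
pair-⊆ {a = a} {b} Xa Xb i ab-i with fin-cases i a | fin-cases i b
... | inj₁ refl | _         = Xa
... | inj₂ _    | inj₁ refl = Xb
... | inj₂ i≢a  | inj₂ i≢b  = clash ab-i (pair-off a b i i≢a i≢b)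

⊆-false : {X Y : Subset n} → X ⊆ Y → ∀ i → Y i ≡ false → X i ≡ false
⊆-false {X = X} X⊆Y i Yi with X i in Xi
... | true  = clash (X⊆Y i Xi) Yi
... | false = refl

supported⇒⊆ : {c X : Vect n} → SupportedOn c X → c ⊆ X
supported⇒⊆ {X = X} c∈X i ci with X i in Xi
... | true  = refl
... | false = clash ci (c∈X i Xi)

Σ₂-cong : {f g : Fin n → Bool} → (∀ i → f i ≡ g i) → Σ₂ f ≡ Σ₂ g
Σ₂-cong {n = ℕ.zero}  f≗g = refl
Σ₂-cong {n = ℕ.suc n} f≗g = cong₂ _xor_ (f≗g zero) (Σ₂-cong (f≗g ∘ suc))

Σ₂-zero : {f : Fin n → Bool} → (∀ i → f i ≡ false) → Σ₂ f ≡ false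
Σ₂-zero {n = ℕ.zero}  f≗0 = refl
Σ₂-zero {n = ℕ.suc n} f≗0 rewrite f≗0 zero = Σ₂-zero (f≗0 ∘ suc)

Σ₂-xor : (f g : Fin n → Bool) → Σ₂ (λ i → f i xor g i) ≡ (Σ₂ f xor Σ₂ g)
Σ₂-xor {n = ℕ.zero}  f g = refl
Σ₂-xor {n = ℕ.suc n} f g =
  trans (cong ((f zero xor g zero) xor_) (Σ₂-xor (f ∘ suc) (g ∘ suc)))
        (xor-interchange (f zero) (g zero) _ _)

Σ₂-single : (f : Fin n → Bool) (i : Fin n) → (∀ j → j ≢ i → f j ≡ false) → Σ₂ f ≡ f i
Σ₂-single f zero f≗0 =
  trans (cong (f zero xor_) (Σ₂-zero (λ j → f≗0 (suc j) λ ())))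
        (xor-identityʳ (f zero))
Σ₂-single f (suc i) f≗0 rewrite f≗0 zero (λ ()) =
  Σ₂-single (f ∘ suc) i (λ j j≢i → f≗0 (suc j) (j≢i ∘ suc-injective))

Σ₂-δ : (h : Fin n → Bool) (a : Fin n) → Σ₂ (λ k → h k ∧ δ a k) ≡ h a
Σ₂-δ h a =
  trans (Σ₂-single _ a λ k k≢a → trans (cong (h k ∧_) (δ-off a k k≢a)) (∧-zeroʳ (h k)))
        (trans (cong (h a ∧_) (δ-diag a)) (∧-identityʳ (h a)))

Σ₂-pair : (h : Fin n → Bool) (a b : Fin n) → a ≢ b →
          (∀ k → k ≢ a → k ≢ b → h k ≡ false) → Σ₂ h ≡ (h a xor h b)
Σ₂-pair h a b a≢b h≗0 = begin
  Σ₂ h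
    ≡⟨ Σ₂-cong split ⟩
  Σ₂ (λ k → (h k ∧ δ a k) xor (h k ∧ δ b k))
    ≡⟨ Σ₂-xor (λ k → h k ∧ δ a k) (λ k → h k ∧ δ b k) ⟩
  Σ₂ (λ k → h k ∧ δ a k) xor Σ₂ (λ k → h k ∧ δ b k)
    ≡⟨ cong₂ _xor_ (Σ₂-δ h a) (Σ₂-δ h b) ⟩
  h a xor h b
    ∎
  where
  open ≡-Reasoning
  split : ∀ k → h k ≡ ((h k ∧ δ a k) xor (h k ∧ δ b k))
  split k with k ≟ a
  ... | yes refl rewrite δ-off b k a≢b | ∧-identityʳ (h k) | ∧-zeroʳ (h k) =
    sym (xor-identityʳ (h k))
  ... | no k≢a with k ≟ b
  ...   | yes refl rewrite ∧-identityʳ (h k) | ∧-zeroʳ (h k) = refl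
  ...   | no k≢b rewrite ∧-zeroʳ (h k) = h≗0 k k≢a k≢b

Σ₂-swap : (f : Fin m → Fin n → Bool) →
          Σ₂ (λ i → Σ₂ (λ j → f i j)) ≡ Σ₂ (λ j → Σ₂ (λ i → f i j))
Σ₂-swap {m = ℕ.zero}  {n} f = sym (Σ₂-zero {n = n} (λ _ → refl))
Σ₂-swap {m = ℕ.suc m} f =
  trans (cong (Σ₂ (f zero) xor_) (Σ₂-swap (f ∘ suc)))
        (sym (Σ₂-xor (f zero) (λ j → Σ₂ (λ i → f (suc i) j))))

Σ₂-∧ˡ : (b : Bool) (f : Fin n → Bool) → (b ∧ Σ₂ f) ≡ Σ₂ (λ i → b ∧ f i)
Σ₂-∧ˡ     true  f = refl
Σ₂-∧ˡ {n} false f = sym (Σ₂-zero {n = n} (λ _ → refl))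

Σ₂-∧ʳ : (b : Bool) (f : Fin n → Bool) → (Σ₂ f ∧ b) ≡ Σ₂ (λ i → f i ∧ b)
Σ₂-∧ʳ b f = trans (∧-comm (Σ₂ f) b)
                  (trans (Σ₂-∧ˡ b f) (Σ₂-cong (λ i → ∧-comm b (f i))))

col : Matrix m n → Fin n → Vect m
col B j i = B i j

_⊙_ : ∀ {k} → Matrix m k → Matrix k n → Matrix m n
(B ⊙ F) i w = (B ·v col F w) i

·v-cong : (B : Matrix m n) {c d : Vect n} → c ≗ d → B ·v c ≗ B ·v d
·v-cong B c≗d i = Σ₂-cong (λ j → cong (B i j ∧_) (c≗d j))

·v-⊕ : (B : Matrix m n) (c d : Vect n) → B ·v (c ⊕ d) ≗ (B ·v c) ⊕ (B ·v d)
·v-⊕ B c d i = trans (Σ₂-cong (λ j → ∧-distribˡ-xor (B i j) (c j) (d j)))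
                     (Σ₂-xor (λ j → B i j ∧ c j) (λ j → B i j ∧ d j))

·v-⊕-kernel : (B : Matrix m n) (c : Vect n) {d : Vect n} → IsZero (B ·v d) →
              B ·v (c ⊕ d) ≗ B ·v c
·v-⊕-kernel B c {d} Bd≡0 i =
  trans (·v-⊕ B c d i) (trans (cong ((B ·v c) i xor_) (Bd≡0 i)) (xor-identityʳ ((B ·v c) i)))

·v-δ : (B : Matrix m n) (j : Fin n) → B ·v δ j ≗ col B j
·v-δ B j i = Σ₂-δ (B i) j

·v-zero : (B : Matrix m n) {c : Vect n} → IsZero c → IsZero (B ·v c)
·v-zero B c≗0 i = Σ₂-zero (λ j → trans (cong (B i j ∧_) (c≗0 j)) (∧-zeroʳ (B i j)))

·v-⊙ : ∀ {k} (B : Matrix m k) (F : Matrix k n) (y : Vect n) → B ·v (F ·v y) ≗ (B ⊙ F) ·v y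
·v-⊙ B F y i = begin
  Σ₂ (λ k → B i k ∧ Σ₂ (λ w → F k w ∧ y w))
    ≡⟨ Σ₂-cong (λ k → Σ₂-∧ˡ (B i k) (λ w → F k w ∧ y w)) ⟩
  Σ₂ (λ k → Σ₂ (λ w → B i k ∧ (F k w ∧ y w)))
    ≡⟨ Σ₂-cong (λ k → Σ₂-cong (λ w → sym (∧-assoc (B i k) (F k w) (y w)))) ⟩
  Σ₂ (λ k → Σ₂ (λ w → (B i k ∧ F k w) ∧ y w))
    ≡⟨ Σ₂-swap (λ k w → (B i k ∧ F k w) ∧ y w) ⟩
  Σ₂ (λ w → Σ₂ (λ k → (B i k ∧ F k w) ∧ y w))
    ≡⟨ Σ₂-cong (λ w → sym (Σ₂-∧ʳ (y w) (λ k → B i k ∧ F k w))) ⟩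
  Σ₂ (λ w → (B ⊙ F) i w ∧ y w)
    ∎
  where open ≡-Reasoning

SymmetricMatrix : Matrix n n → Set
SymmetricMatrix A = ∀ i j → A i j ≡ A j i

·v-as-inner : {A : Matrix n n} → SymmetricMatrix A → ∀ v i → (A ·v v) i ≡ ⟨ col A i , v ⟩
·v-as-inner A-sym v i = Σ₂-cong (λ k → cong (_∧ v k) (A-sym i k))

⟨⟩-self-adjoint : {A : Matrix n n} → SymmetricMatrix A → ∀ y v → ⟨ A ·v y , v ⟩ ≡ ⟨ y , A ·v v ⟩
⟨⟩-self-adjoint {A = A} A-sym y v = begin
  Σ₂ (λ i → Σ₂ (λ j → A i j ∧ y j) ∧ v i)
    ≡⟨ Σ₂-cong (λ i → Σ₂-∧ʳ (v i) (λ j → A i j ∧ y j)) ⟩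
  Σ₂ (λ i → Σ₂ (λ j → (A i j ∧ y j) ∧ v i))
    ≡⟨ Σ₂-swap (λ i j → (A i j ∧ y j) ∧ v i) ⟩
  Σ₂ (λ j → Σ₂ (λ i → (A i j ∧ y j) ∧ v i))
    ≡⟨ Σ₂-cong (λ j → Σ₂-cong (λ i → rearrange i j)) ⟩
  Σ₂ (λ j → Σ₂ (λ i → y j ∧ (A j i ∧ v i)))
    ≡⟨ Σ₂-cong (λ j → sym (Σ₂-∧ˡ (y j) (λ i → A j i ∧ v i))) ⟩
  Σ₂ (λ j → y j ∧ (A ·v v) j)
    ∎
  where
  open ≡-Reasoning
  rearrange : ∀ i j → ((A i j ∧ y j) ∧ v i) ≡ (y j ∧ (A j i ∧ v i))
  rearrange i j rewrite A-sym i j | ∧-comm (A j i) (y j) = ∧-assoc (y j) (A j i) (v i)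

⟨⟩-congˡ : {u u′ : Vect n} → u ≗ u′ → ∀ v → ⟨ u , v ⟩ ≡ ⟨ u′ , v ⟩
⟨⟩-congˡ u≗u′ v = Σ₂-cong (λ x → cong (_∧ v x) (u≗u′ x))

⟨⟩-zeroʳ : (u : Vect n) {v : Vect n} → IsZero v → ⟨ u , v ⟩ ≡ false
⟨⟩-zeroʳ u v≗0 = Σ₂-zero (λ x → trans (cong (u x ∧_) (v≗0 x)) (∧-zeroʳ (u x)))

span-cong : {P : Vect n → Set} {v w : Vect n} → Span P v → v ≗ w → Span P w
span-cong (span-zero v≗0)       v≗w = span-zero (λ j → trans (sym (v≗w j)) (v≗0 j))
span-cong (span-add PC span eq) v≗w = span-add PC span (λ i → trans (sym (v≗w i)) (eq i))

span-map : {P Q : Vect n → Set} → (∀ C → P C → Q C) → ∀ {v} → Span P v → Span Q v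
span-map P⇒Q (span-zero v≗0)       = span-zero v≗0
span-map P⇒Q (span-add PC span eq) = span-add (P⇒Q _ PC) (span-map P⇒Q span) eq

span-add-scaled : {P : Vect n → Set} {C v : Vect n} (b : Bool) → (b ≡ true → P C) →
                  Span P v → Span P (λ i → (C i ∧ b) xor v i)
span-add-scaled {C = C} {v} true  PC span =
  span-add (PC refl) span
           (λ i → trans (cong (_xor v i) (∧-identityʳ (C i))) (Bool.xor-comm (C i) (v i)))
span-add-scaled {C = C} {v} false PC span =
  span-cong span (λ i → cong (_xor v i) (sym (∧-zeroʳ (C i))))

span-columns : {P : Vect m → Set} (A : Matrix m n) (y : Vect n) →
               (∀ j → y j ≡ true → P (col A j)) → Span P (A ·v y)
span-columns {n = ℕ.zero}  A y P-col = span-zero (λ _ → refl)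
span-columns {n = ℕ.suc n} A y P-col =
  span-add-scaled (y zero) (P-col zero)
                  (span-columns (λ i j → A i (suc j)) (y ∘ suc) (P-col ∘ suc))

span-kernel : {P : Vect n → Set} (B : Matrix m n) → (∀ C → P C → IsZero (B ·v C)) →
              ∀ {v} → Span P v → IsZero (B ·v v)
span-kernel B ker (span-zero v≗0) = ·v-zero B v≗0
span-kernel B ker (span-add {v} {C} PC span eq) i =
  trans (·v-cong B eq i) (trans (·v-⊕-kernel B v (ker C PC) i) (span-kernel B ker span i))

≋-sym : {M N : SetSystem n} → M ≋ N → N ≋ M
≋-sym M≋N X = mk⇔ (from (M≋N X)) (to (M≋N X))

independent-≋ : {M N : SetSystem n} → M ≋ N → ∀ {X} → Independent M X → Independent N X
independent-≋ M≋N (Y , MY , X⊆Y) = Y , to (M≋N Y) MY , X⊆Y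

circuit-≋ : {M N : SetSystem n} → M ≋ N → ∀ C → Circuit M C → Circuit N C
circuit-≋ M≋N C (dep , minimal) =
  dep ∘ independent-≋ (≋-sym M≋N) , λ D D⊊C → independent-≋ M≋N (minimal D D⊊C)

CS-≋ : {M N : SetSystem n} → M ≋ N → ∀ v → CS M v ⇔ CS N v
CS-≋ M≋N v = mk⇔ (span-map (circuit-≋ M≋N)) (span-map (circuit-≋ (≋-sym M≋N)))

-- Exhaustive search: existence over the finite set GF(2)^n is decidable for
-- decidable predicates that respect pointwise equality.
∃-vect? : (P : Vect n → Set) → (∀ {c d} → c ≗ d → P c → P d) → (∀ c → Dec (P c)) →
          Dec (Σ (Vect n) P)
∃-vect? P resp P? =
  map′ (λ (s , p) → lookup s , p)
       (λ (c , p) → tabulate c , resp (λ i → sym (lookup∘tabulate c i)) p)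
       (anySubset? (P? ∘ lookup))

supportedOn? : (c X : Vect n) → Dec (SupportedOn c X)
supportedOn? c X = all? (λ j → (X j Bool.≟ false) →-dec (c j Bool.≟ false))

isZero? : (c : Vect n) → Dec (IsZero c)
isZero? c = all? (λ j → c j Bool.≟ false)

≗? : (u v : Vect n) → Dec (u ≗ v)
≗? u v = all? (λ i → u i Bool.≟ v i)

supported-cong : {c d X : Vect n} → c ≗ d → SupportedOn c X → SupportedOn d X
supported-cong c≗d c∈X k Xk = trans (sym (c≗d k)) (c∈X k Xk)

insert : Fin n → Subset n → Subset n
insert j X i = X i ∨ δ j i

insert-self : (j : Fin n) (X : Subset n) → insert j X j ≡ true
insert-self j X rewrite δ-diag j = ∨-zeroʳ (X j)

insert-⊇ : (j : Fin n) (X : Subset n) → X ⊆ insert j X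
insert-⊇ j X i Xi rewrite Xi = refl

insert-off : {j i : Fin n} (X : Subset n) → X i ≡ false → i ≢ j → insert j X i ≡ false
insert-off {j = j} {i} X Xi i≢j rewrite Xi = δ-off j i i≢j

module ColumnMatroidTheory (B : Matrix m n) where

  Spans : Subset n → Fin n → Set
  Spans X j = Σ (Vect n) λ c → SupportedOn c X × (B ·v c ≗ col B j)

  ·v-⊕δ : (c : Vect n) (j : Fin n) → B ·v (c ⊕ δ j) ≗ (B ·v c) ⊕ col B j
  ·v-⊕δ c j i = trans (·v-⊕ B c (δ j) i) (cong ((B ·v c) i xor_) (·v-δ B j i))

  ⊕δ-kernel : ∀ {c j} → B ·v c ≗ col B j → IsZero (B ·v (c ⊕ δ j))
  ⊕δ-kernel {c} {j} Bc i = trans (·v-⊕δ c j i) (trans (cong (_xor B i j) (Bc i)) (xor-same (B i j)))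

  spans? : ∀ X j → Dec (Spans X j)
  spans? X j = ∃-vect? _ respects (λ c → supportedOn? c X ×-dec ≗? (B ·v c) (col B j))
    where
    respects : ∀ {c d} → c ≗ d → SupportedOn c X × (B ·v c ≗ col B j) →
                            SupportedOn d X × (B ·v d ≗ col B j)
    respects c≗d (c∈X , Bc) =
      supported-cong c≗d c∈X , λ i → trans (sym (·v-cong B c≗d i)) (Bc i)

  spans-mono : ∀ {X Y} → X ⊆ Y → ∀ {j} → Spans X j → Spans Y j
  spans-mono X⊆Y (c , c∈X , Bc) = c , (λ k Yk → c∈X k (⊆-false X⊆Y k Yk)) , Bc

  spans-member : ∀ {X} j → X j ≡ true → Spans X j
  spans-member {X} j Xj = δ j , δ∈X , ·v-δ B j
    where
    δ∈X : SupportedOn (δ j) X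
    δ∈X k Xk with k ≟ j
    ... | yes refl = clash Xj Xk
    ... | no k≢j   = refl

  insert-independent : ∀ {X} j → ColIndependent B X → ¬ Spans X j →
                       ColIndependent B (insert j X)
  insert-independent {X} j X-ind ¬spans c c∈X+j Bc≡0 with c j in cj
  ... | true  = contradiction (c ⊕ δ j , c⊕δ∈X , Bc⊕δ) ¬spans
    where
    Bc⊕δ : B ·v (c ⊕ δ j) ≗ col B j
    Bc⊕δ i = trans (·v-⊕δ c j i) (cong (_xor B i j) (Bc≡0 i))
    c⊕δ∈X : SupportedOn (c ⊕ δ j) X
    c⊕δ∈X i Xi with i ≟ j
    ... | yes refl rewrite cj = refl
    ... | no i≢j rewrite c∈X+j i (insert-off X Xi i≢j) = refl
  ... | false = X-ind c c∈X Bc≡0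
    where
    c∈X : SupportedOn c X
    c∈X i Xi with i ≟ j
    ... | yes refl = cj
    ... | no i≢j   = c∈X+j i (insert-off X Xi i≢j)

  greedy : ∀ {X} → ColIndependent B X → (js : List (Fin n)) →
           Σ (Subset n) λ Y → ColIndependent B Y × X ⊆ Y × (∀ k → k ∈ js → Spans Y k)
  greedy {X} X-ind []       = X , X-ind , (λ _ Xi → Xi) , λ _ ()
  greedy {X} X-ind (j ∷ js) with spans? X j
  ... | yes X-spans-j =
    let (Y , Y-ind , X⊆Y , Y-spans) = greedy X-ind js in
    Y , Y-ind , X⊆Y ,
    λ { k (here refl) → spans-mono X⊆Y X-spans-j ; k (there k∈js) → Y-spans k k∈js }
  ... | no ¬spans =
    let (Y , Y-ind , X+j⊆Y , Y-spans) = greedy (insert-independent j X-ind ¬spans) js in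
    Y , Y-ind , (λ i Xi → X+j⊆Y i (insert-⊇ j X i Xi)) ,
    λ { k (here refl) → spans-member k (X+j⊆Y k (insert-self k X))
      ; k (there k∈js) → Y-spans k k∈js }

  basis-extension : ∀ {X} → ColIndependent B X → Σ (Subset n) λ Y → ColumnMatroid B Y × X ⊆ Y
  basis-extension X-ind =
    let (Y , Y-ind , X⊆Y , Y-spans) = greedy X-ind (allFin _) in
    Y , (Y-ind , λ j → Y-spans j (∈-allFin j)) , X⊆Y

  basis-exists : Σ (Subset n) (ColumnMatroid B)
  basis-exists =
    let (Y , Y-basis , _) = basis-extension (λ c c∈∅ _ j → c∈∅ j refl) in Y , Y-basis

  independent⇔ : ∀ {X} → Independent (ColumnMatroid B) X ⇔ ColIndependent B X
  independent⇔ = mk⇔ (λ (Y , (Y-ind , _) , X⊆Y) c c∈X →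
                        Y-ind c λ k Yk → c∈X k (⊆-false X⊆Y k Yk))
                     basis-extension

  kernel-witness : ∀ {X} → ¬ ColIndependent B X →
                   Σ (Vect n) λ c → SupportedOn c X × IsZero (B ·v c) × ∃ λ j → c j ≡ true
  kernel-witness {X} ¬ind
    with ∃-vect? _ respects (λ c → supportedOn? c X ×-dec isZero? (B ·v c) ×-dec
                                    any? (λ j → c j Bool.≟ true))
    where
    respects : ∀ {c d} → c ≗ d →
               SupportedOn c X × IsZero (B ·v c) × ∃ (λ j → c j ≡ true) →
               SupportedOn d X × IsZero (B ·v d) × ∃ (λ j → d j ≡ true)
    respects c≗d (c∈X , Bc≡0 , j , cj) =
      supported-cong c≗d c∈X , (λ i → trans (sym (·v-cong B c≗d i)) (Bc≡0 i)) ,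
      j , trans (sym (c≗d j)) cj
  ... | yes witness = witness
  ... | no ∄witness = contradiction independent ¬ind
    where
    independent : ColIndependent B X
    independent c c∈X Bc≡0 j with c j in cj
    ... | true  = contradiction (c , c∈X , Bc≡0 , j , cj) ∄witness
    ... | false = refl

  -- Every circuit of the column matroid is (the incidence vector of) a kernel vector:
  -- a dependent set carries a nonzero kernel vector, and minimality forces its
  -- support to be the whole circuit.
  circuit-kernel : ∀ C → Circuit (ColumnMatroid B) C → IsZero (B ·v C)
  circuit-kernel C (dependent , minimal)
    with kernel-witness (dependent ∘ from independent⇔)
  ... | c , c∈C , Bc≡0 , j , cj = λ i → trans (sym (·v-cong B c≗C i)) (Bc≡0 i)
    where
    c≗C : c ≗ C
    c≗C k with C k in Ck
    ... | false = c∈C k Ck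
    ... | true with c k in ck
    ...   | true  = refl
    ...   | false = clash cj (c-independent c (λ _ e → e) Bc≡0 j)
      where
      c-independent : ColIndependent B c
      c-independent = to independent⇔ (minimal c (supported⇒⊆ c∈C , k , Ck , ck))

  spanning⊆independent : ∀ {X Y} → ColSpanning B X → ColIndependent B Y → X ⊆ Y → Y ⊆ X
  spanning⊆independent {X} {Y} X-span Y-ind X⊆Y v Yv with X v in Xv | X-span v
  ... | true  | _ = refl
  ... | false | c , c∈X , Bc = clash d-v (Y-ind d d∈Y (⊕δ-kernel Bc) v)
    where
    d = c ⊕ δ v
    d∈Y : SupportedOn d Y
    d∈Y i Yi = cong₂ _xor_ (c∈X i (⊆-false X⊆Y i Yi))
                           (δ-off v i λ { refl → clash Yv Yi })
    d-v : d v ≡ true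
    d-v = cong₂ _xor_ (c∈X v Xv) (δ-diag v)

  Δ-basis-inside : ∀ {X Z} → ColumnMatroid B Z → ColumnMatroid B (X ⊕ Z) → X ⊆ Z →
                   ∀ v → X v ≡ false
  Δ-basis-inside {X} {Z} (Z-ind , _) (_ , XZ-span) X⊆Z v with X v in Xv
  ... | false = refl
  ... | true  = clash (Z⊆XZ v (X⊆Z v Xv)) XZ-v
    where
    XZ⊆Z : (X ⊕ Z) ⊆ Z
    XZ⊆Z i XZi with Z i in Zi
    ... | true  = refl
    ... | false = clash XZi (cong (_xor false) (⊆-false X⊆Z i Zi))
    Z⊆XZ : Z ⊆ (X ⊕ Z)
    Z⊆XZ = spanning⊆independent XZ-span Z-ind XZ⊆Z
    XZ-v : (X ⊕ Z) v ≡ false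
    XZ-v rewrite Xv | X⊆Z v Xv = refl

  Δ-basis-outside : ∀ {X Z} → ColumnMatroid B Z → ColumnMatroid B (X ⊕ Z) → X ⊆ ∁ Z →
                    ∀ v → X v ≡ false
  Δ-basis-outside {X} {Z} (_ , Z-span) (XZ-ind , _) X⊆∁Z v with X v in Xv
  ... | false = refl
  ... | true  = clash (XZ⊆Z v XZ-v) Zv
    where
    disjoint : ∀ {i} → X i ≡ true → Z i ≡ false
    disjoint {i} Xi with Z i | X⊆∁Z i Xi
    ... | false | _ = refl
    Z⊆XZ : Z ⊆ (X ⊕ Z)
    Z⊆XZ i Zi with X i in Xi
    ... | false = Zi
    ... | true  = clash Zi (disjoint Xi)
    XZ⊆Z : (X ⊕ Z) ⊆ Z
    XZ⊆Z = spanning⊆independent Z-span XZ-ind Z⊆XZ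
    Zv : Z v ≡ false
    Zv = disjoint Xv
    XZ-v : (X ⊕ Z) v ≡ true
    XZ-v rewrite Xv | Zv = refl

module FundamentalCircuits {B : Matrix m n} {Y : Subset n} (Y-basis : ColumnMatroid B Y) where

  open ColumnMatroidTheory B

  Y-independent : ColIndependent B Y
  Y-independent = proj₁ Y-basis

  -- rep w: the coordinates of column w with respect to the basis Y.
  rep : Fin n → Vect n
  rep w = proj₁ (proj₂ Y-basis w)

  rep-supported : ∀ w → SupportedOn (rep w) Y
  rep-supported w = proj₁ (proj₂ (proj₂ Y-basis w))

  rep-col : ∀ w → B ·v rep w ≗ col B w
  rep-col w = proj₂ (proj₂ (proj₂ Y-basis w))

  fund : Fin n → Vect n
  fund w = rep w ⊕ δ w

  fund-kernel : ∀ w → IsZero (B ·v fund w)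
  fund-kernel w = ⊕δ-kernel (rep-col w)

  fund-self : ∀ {w} → Y w ≡ false → fund w w ≡ true
  fund-self {w} Yw = cong₂ _xor_ (rep-supported w w Yw) (δ-diag w)

  fund-on : ∀ {w i} → i ≢ w → fund w i ≡ rep w i
  fund-on {w} {i} i≢w = trans (cong (rep w i xor_) (δ-off w i i≢w)) (xor-identityʳ (rep w i))

  fund-off : ∀ {w i} → Y i ≡ false → i ≢ w → fund w i ≡ false
  fund-off {w} {i} Yi i≢w = trans (fund-on i≢w) (rep-supported w i Yi)

  fund-⊆ : ∀ {w i} → i ≢ w → fund w i ≡ true → Y i ≡ true
  fund-⊆ {w} {i} i≢w fi = supported⇒⊆ (rep-supported w) i (trans (sym (fund-on i≢w)) fi)

  module Exchange {z w : Fin n} (Yz : Y z ≡ true) (Yw : Y w ≡ false) where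

    Y′ : Subset n
    Y′ = pair z w ⊕ Y

    ≢z : ∀ {i} → Y i ≡ false → i ≢ z
    ≢z Yi refl = clash Yz Yi

    z≢w : z ≢ w
    z≢w = ≢z Yw ∘ sym

    Y′-w : Y′ w ≡ true
    Y′-w rewrite pair-snd z w | Yw = refl

    Y′-off : ∀ {i} → i ≢ z → i ≢ w → Y′ i ≡ Y i
    Y′-off {i} i≢z i≢w rewrite pair-off z w i i≢z i≢w = refl

    supported-Y′ : ∀ {c} → c z ≡ false → (∀ i → i ≢ w → Y i ≡ false → c i ≡ false) →
                   SupportedOn c Y′
    supported-Y′ cz c-off i Y′i with fin-cases i z | fin-cases i w
    ... | inj₁ refl | _         = cz
    ... | inj₂ i≢z  | inj₁ refl = clash Y′-w Y′i
    ... | inj₂ i≢z  | inj₂ i≢w  = c-off i i≢w (trans (sym (Y′-off i≢z i≢w)) Y′i)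

    -- If z does not occur in the representation of w, then fund w lies in Y′,
    -- so Y′ is dependent.
    exchange-needs-rep : ColIndependent B Y′ → rep w z ≡ true
    exchange-needs-rep Y′-ind with rep w z in rwz
    ... | true  = refl
    ... | false = clash (fund-self Yw) (Y′-ind (fund w) fund∈Y′ (fund-kernel w) w)
      where
      fund∈Y′ : SupportedOn (fund w) Y′
      fund∈Y′ = supported-Y′ (trans (fund-on z≢w) rwz) (λ i i≢w Yi → fund-off Yi i≢w)

    module _ (rwz : rep w z ≡ true) where

      -- A kernel vector c on Y′ vanishes at w (otherwise c + fund w is a kernel
      -- vector on Y that is nonzero at z), hence lives on Y and is zero.
      exchange-independent : ColIndependent B Y′
      exchange-independent c c∈Y′ Bc≡0 = Y-independent c c∈Y Bc≡0
        where
        cz : c z ≡ false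
        cz = c∈Y′ z (cong₂ _xor_ (pair-fst z w) Yz)
        cw : c w ≡ false
        cw with c w in cw′
        ... | false = refl
        ... | true  = clash c+f-z (c+f≡0 z)
          where
          c+f∈Y : SupportedOn (c ⊕ fund w) Y
          c+f∈Y i Yi with fin-cases i w
          ... | inj₁ refl = cong₂ _xor_ cw′ (fund-self Yw)
          ... | inj₂ i≢w  =
            cong₂ _xor_ (c∈Y′ i (trans (Y′-off (≢z Yi) i≢w) Yi))
                        (fund-off Yi i≢w)
          c+f≡0 : IsZero (c ⊕ fund w)
          c+f≡0 = Y-independent _ c+f∈Y
                    (λ i → trans (·v-⊕-kernel B c (fund-kernel w) i) (Bc≡0 i))
          c+f-z : (c ⊕ fund w) z ≡ true
          c+f-z = cong₂ _xor_ cz (trans (fund-on z≢w) rwz)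
        c∈Y : SupportedOn c Y
        c∈Y i Yi with fin-cases i w
        ... | inj₁ refl = cw
        ... | inj₂ i≢w  = c∈Y′ i (trans (Y′-off (≢z Yi) i≢w) Yi)

      -- Column j is represented on Y′ by rep j, corrected by fund w when z occurs in it.
      exchange-spanning : ColSpanning B Y′
      exchange-spanning j with rep j z in rjz
      ... | false = rep j , supported-Y′ rjz (λ i _ Yi → rep-supported j i Yi) , rep-col j
      ... | true  = rep j ⊕ fund w ,
                    supported-Y′ (cong₂ _xor_ rjz (trans (fund-on z≢w) rwz))
                                 (λ i i≢w Yi → cong₂ _xor_ (rep-supported j i Yi)
                                                           (fund-off Yi i≢w)) ,
                    λ i → trans (·v-⊕-kernel B (rep j) (fund-kernel w) i) (rep-col j i)

    exchange : ColumnMatroid B Y′ ⇔ (rep w z ≡ true)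
    exchange = mk⇔ (exchange-needs-rep ∘ proj₁)
                   (λ rwz → exchange-independent rwz , exchange-spanning rwz)

  -- For w ∉ Y, fund w is a circuit: it is a nonzero kernel vector, and removing
  -- any element x leaves a set inside Y (if x = w) or inside the exchanged
  -- basis {x, w} Δ Y (if x ≠ w).
  fund-circuit : ∀ w → Y w ≡ false → Circuit (ColumnMatroid B) (fund w)
  fund-circuit w Yw = dependent , minimal
    where
    dependent : Dependent (ColumnMatroid B) (fund w)
    dependent indep = clash (fund-self Yw)
                        (to independent⇔ indep (fund w) (λ _ e → e) (fund-kernel w) w)
    minimal : ∀ D → D ⊊ fund w → Independent (ColumnMatroid B) D
    minimal D (D⊆f , x , fx , Dx) with fin-cases x w
    ... | inj₁ refl = Y , Y-basis , D⊆Y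
      where
      D⊆Y : D ⊆ Y
      D⊆Y i Di with fin-cases i x
      ... | inj₁ refl = clash Di Dx
      ... | inj₂ i≢x  = fund-⊆ i≢x (D⊆f i Di)
    ... | inj₂ x≢w  = Y′ , from exchange (trans (sym (fund-on x≢w)) fx) , D⊆Y′
      where
      open Exchange (fund-⊆ x≢w fx) Yw
      D⊆Y′ : D ⊆ Y′
      D⊆Y′ i Di with fin-cases i x | fin-cases i w
      ... | inj₁ refl | _         = clash Di Dx
      ... | inj₂ _    | inj₁ refl = Y′-w
      ... | inj₂ i≢x  | inj₂ i≢w  = trans (Y′-off i≢x i≢w) (fund-⊆ i≢w (D⊆f i Di))

  module FundamentalMatrix (F : Matrix n n) (F-col : ∀ w → Y w ≡ false → col F w ≗ fund w) where

    comb : Vect n → Vect n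
    comb x = F ·v (x ↾ ∁ Y)

    comb-kernel : ∀ x → IsZero (B ·v comb x)
    comb-kernel x i = trans (·v-⊙ B F (x ↾ ∁ Y) i) (Σ₂-zero term)
      where
      term : ∀ w → ((B ⊙ F) i w ∧ (x ↾ ∁ Y) w) ≡ false
      term w with Y w in Yw
      ... | true  rewrite ∧-zeroʳ (x w) = ∧-zeroʳ ((B ⊙ F) i w)
      ... | false = cong (_∧ (x w ∧ true)) (trans (·v-cong B (F-col w Yw) i) (fund-kernel w i))

    -- Outside Y, fund i is the only fundamental circuit containing i.
    comb-off : ∀ x i → Y i ≡ false → comb x i ≡ x i
    comb-off x i Yi = trans (Σ₂-single _ i term) diagonal
      where
      term : ∀ w → w ≢ i → (F i w ∧ (x ↾ ∁ Y) w) ≡ false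
      term w w≢i with Y w in Yw
      ... | true  rewrite ∧-zeroʳ (x w) = ∧-zeroʳ (F i w)
      ... | false = cong (_∧ (x w ∧ true)) (trans (F-col w Yw i) (fund-off Yi (w≢i ∘ sym)))
      diagonal : (F i i ∧ (x ↾ ∁ Y) i) ≡ x i
      diagonal rewrite F-col i Yi i | fund-self Yi | Yi = ∧-identityʳ (x i)

    kernel-decomposition : ∀ {x} → IsZero (B ·v x) → x ≗ comb x
    kernel-decomposition {x} Bx≡0 i = xor≡false⇒≡ (d≡0 i)
      where
      d∈Y : SupportedOn (x ⊕ comb x) Y
      d∈Y j Yj rewrite comb-off x j Yj = xor-same (x j)
      d≡0 : IsZero (x ⊕ comb x)
      d≡0 = Y-independent _ d∈Y
              (λ j → trans (·v-⊕-kernel B x (comb-kernel x) j) (Bx≡0 j))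

    kernel-from-Y : ∀ {x} → (∀ i → Y i ≡ true → x i ≡ comb x i) → IsZero (B ·v x)
    kernel-from-Y {x} agree j = trans (·v-cong B x≗comb j) (comb-kernel x j)
      where
      x≗comb : x ≗ comb x
      x≗comb i with Y i in Yi
      ... | true  = agree i Yi
      ... | false = sym (comb-off x i Yi)

cycle-space-is-kernel : (B : Matrix m n) → ∀ v → CS (ColumnMatroid B) v ⇔ IsZero (B ·v v)
cycle-space-is-kernel B v = mk⇔ (span-kernel B circuit-kernel) spanned
  where
  open ColumnMatroidTheory B
  Y = proj₁ basis-exists
  open FundamentalCircuits (proj₂ basis-exists)
  F : Matrix _ _
  F i w = fund w i
  open FundamentalMatrix F (λ _ _ _ → refl)
  spanned : IsZero (B ·v v) → CS (ColumnMatroid B) v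
  spanned Bv≡0 =
    span-cong (span-columns F (v ↾ ∁ Y) λ j vj → fund-circuit j (↾∁-true Y {v} vj))
              (sym ∘ kernel-decomposition Bv≡0)

singleton-nonsingular : (A : Matrix n n) (v : Fin n) → A v v ≡ true → Nonsingular[ A ] (δ v)
singleton-nonsingular A v Avv c c∈v Ac≡0 i with fin-cases i v
... | inj₂ i≢v  = c∈v i (δ-off v i i≢v)
... | inj₁ refl = trans (sym row) (Ac≡0 i (δ-diag i))
  where
  row : (A ·v c) i ≡ c i
  row = trans (Σ₂-single _ i λ k k≢i →
                 trans (cong (A i k ∧_) (c∈v k (δ-off i k k≢i))) (∧-zeroʳ (A i k)))
              (cong (_∧ c i) Avv)

·v-pair : (A : Matrix n n) {a b : Fin n} {c : Vect n} → a ≢ b → SupportedOn c (pair a b) →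
          ∀ i → (A ·v c) i ≡ ((A i a ∧ c a) xor (A i b ∧ c b))
·v-pair A {a} {b} {c} a≢b c∈ab i =
  Σ₂-pair _ a b a≢b λ k k≢a k≢b →
    trans (cong (A i k ∧_) (c∈ab k (pair-off a b k k≢a k≢b))) (∧-zeroʳ (A i k))

pair-nonsingular⇔ : (A : Matrix n n) {a b : Fin n} → a ≢ b → A a a ≡ false → A b b ≡ false →
                    A a b ≡ A b a → Nonsingular[ A ] (pair a b) ⇔ (A a b ≡ true)
pair-nonsingular⇔ A {a} {b} a≢b Aaa Abb Aab≡Aba = mk⇔ edge nonsingular
  where
  -- Without the edge, e_a is a nonzero kernel vector of A[{a, b}].
  edge : Nonsingular[ A ] (pair a b) → A a b ≡ true
  edge ns with A a b in Aab
  ... | true  = refl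
  ... | false = clash (δ-diag a) (ns (δ a) δ∈ab Aδ≡0 a)
    where
    δ∈ab : SupportedOn (δ a) (pair a b)
    δ∈ab i ab-i with fin-cases i a
    ... | inj₁ refl = clash (pair-fst i b) ab-i
    ... | inj₂ i≢a  = δ-off a i i≢a
    Aδ≡0 : ∀ i → pair a b i ≡ true → (A ·v δ a) i ≡ false
    Aδ≡0 i ab-i with fin-cases i a | fin-cases i b
    ... | inj₁ refl | _         = trans (·v-δ A i i) Aaa
    ... | inj₂ _    | inj₁ refl = trans (·v-δ A a i) (sym Aab≡Aba)
    ... | inj₂ i≢a  | inj₂ i≢b  = clash ab-i (pair-off a b i i≢a i≢b)
  -- With the edge, row b of A · c reads off c a and row a reads off c b.
  nonsingular : A a b ≡ true → Nonsingular[ A ] (pair a b)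
  nonsingular Aab c c∈ab Ac≡0 i with fin-cases i a | fin-cases i b
  ... | inj₁ refl | _         = trans (sym row-b) (Ac≡0 b (pair-snd a b))
    where
    row-b : (A ·v c) b ≡ c a
    row-b rewrite ·v-pair A a≢b c∈ab b | sym Aab≡Aba | Aab | Abb = xor-identityʳ (c a)
  ... | inj₂ _    | inj₁ refl = trans (sym row-a) (Ac≡0 a (pair-fst a b))
    where
    row-a : (A ·v c) a ≡ c b
    row-a rewrite ·v-pair A a≢b c∈ab a | Aaa | Aab = refl
  ... | inj₂ i≢a  | inj₂ i≢b  = c∈ab i (pair-off a b i i≢a i≢b)

Bicycle : Matrix m n → Vect n → Set
Bicycle B v = IsZero (B ·v v) × (∀ u → IsZero (B ·v u) → ⟨ u , v ⟩ ≡ false)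

module FundamentalGraph {B : Matrix m n} {Z : Subset n} (Z-basis : ColumnMatroid B Z)
                        (G : Graph n)
                        (G-fund : ∀ X → Nonsingular[ adj G ] X ⇔ ColumnMatroid B (X ⊕ Z)) where

  open ColumnMatroidTheory B
  open FundamentalCircuits Z-basis

  g : Matrix n n
  g = adj G

  -- A loop at v would make {v} Δ Z a basis, with {v} on one side of Z.
  no-loops : ∀ v → g v v ≡ false
  no-loops v with g v v in gvv
  ... | false = refl
  ... | true  = clash (δ-diag v) (one-sided (Z v) refl)
    where
    basis : ColumnMatroid B (δ v ⊕ Z)
    basis = to (G-fund (δ v)) (singleton-nonsingular g v gvv)
    one-sided : ∀ b → Z v ≡ b → δ v v ≡ false
    one-sided true  Zv = Δ-basis-inside Z-basis basis (δ-⊆ v Zv) v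
    one-sided false Zv = Δ-basis-outside Z-basis basis (δ-⊆ v (cong not Zv)) v

  edge⇔basis : ∀ {a b} → a ≢ b → (g a b ≡ true) ⇔ ColumnMatroid B (pair a b ⊕ Z)
  edge⇔basis {a} {b} a≢b =
    ⇔.trans (⇔.sym (pair-nonsingular⇔ g a≢b (no-loops a) (no-loops b) (Graph.sym G a b)))
            (G-fund (pair a b))

  no-edges-inside : ∀ {a b} → a ≢ b → Z a ≡ true → Z b ≡ true → g a b ≡ false
  no-edges-inside {a} {b} a≢b Za Zb with g a b in gab
  ... | false = refl
  ... | true  = clash (pair-fst a b)
                      (Δ-basis-inside Z-basis (to (edge⇔basis a≢b) gab) (pair-⊆ Za Zb) a)

  no-edges-outside : ∀ {a b} → a ≢ b → Z a ≡ false → Z b ≡ false → g a b ≡ false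
  no-edges-outside {a} {b} a≢b Za Zb with g a b in gab
  ... | false = refl
  ... | true  = clash (pair-fst a b)
                      (Δ-basis-outside Z-basis (to (edge⇔basis a≢b) gab)
                                       (pair-⊆ (cong not Za) (cong not Zb)) a)

  cross-edges : ∀ {z w} → Z z ≡ true → Z w ≡ false → g z w ≡ rep w z
  cross-edges Zz Zw = bool-ext (⇔.trans (edge⇔basis z≢w) exchange)
    where open Exchange Zz Zw

  A′ : Matrix n n
  A′ = adj+V G

  A′-diag : ∀ i → A′ i i ≡ true
  A′-diag i with i ≟ i
  ... | yes _   = cong not (no-loops i)
  ... | no i≢i = contradiction refl i≢i

  A′-off : ∀ {i j} → i ≢ j → A′ i j ≡ g i j
  A′-off {i} {j} i≢j with i ≟ j
  ... | yes i≡j = contradiction i≡j i≢j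
  ... | no _    = refl

  A′-sym : SymmetricMatrix A′
  A′-sym i j with fin-cases i j
  ... | inj₁ refl = refl
  ... | inj₂ i≢j  = trans (A′-off i≢j) (trans (Graph.sym G i j) (sym (A′-off (i≢j ∘ sym))))

  A′-col : ∀ w → Z w ≡ false → col A′ w ≗ fund w
  A′-col w Zw i with fin-cases i w
  ... | inj₁ refl = trans (A′-diag i) (sym (fund-self Zw))
  ... | inj₂ i≢w with Z i in Zi
  ...   | true  = trans (A′-off i≢w) (trans (cross-edges Zi Zw) (sym (fund-on i≢w)))
  ...   | false = trans (A′-off i≢w)
                          (trans (no-edges-outside i≢w Zi Zw) (sym (fund-off Zi i≢w)))

  A′-row : ∀ {u i} → SupportedOn u Z → Z i ≡ true → (A′ ·v u) i ≡ u i
  A′-row {u} {i} u∈Z Zi = trans (Σ₂-single _ i term) (cong (_∧ u i) (A′-diag i))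
    where
    term : ∀ j → j ≢ i → (A′ i j ∧ u j) ≡ false
    term j j≢i with Z j in Zj
    ... | false = trans (cong (A′ i j ∧_) (u∈Z j Zj)) (∧-zeroʳ (A′ i j))
    ... | true  = cong (_∧ u j) (trans (A′-off (j≢i ∘ sym)) (no-edges-inside (j≢i ∘ sym) Zi Zj))

  open FundamentalMatrix A′ A′-col

  A′-on-Z : ∀ x {i} → Z i ≡ true → (A′ ·v x) i ≡ (x i xor comb x i)
  A′-on-Z x {i} Zi = begin
    (A′ ·v x) i
      ≡⟨ ·v-cong A′ (↾-split Z x) i ⟩
    (A′ ·v ((x ↾ Z) ⊕ (x ↾ ∁ Z))) i
      ≡⟨ ·v-⊕ A′ (x ↾ Z) (x ↾ ∁ Z) i ⟩
    (A′ ·v (x ↾ Z)) i xor comb x i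
      ≡⟨ cong (_xor comb x i) (A′-row (↾-supported Z x) Zi) ⟩
    (x i ∧ Z i) xor comb x i
      ≡⟨ cong (λ b → (x i ∧ b) xor comb x i) Zi ⟩
    (x i ∧ true) xor comb x i
      ≡⟨ cong (_xor comb x i) (∧-identityʳ (x i)) ⟩
    x i xor comb x i
      ∎
    where open ≡-Reasoning

  kernel⇔ : ∀ {x} → IsZero (B ·v x) ⇔ (∀ i → Z i ≡ true → (A′ ·v x) i ≡ false)
  kernel⇔ {x} = mk⇔
    (λ Bx≡0 i Zi → trans (A′-on-Z x Zi)
                         (trans (cong (x i xor_) (sym (kernel-decomposition Bx≡0 i)))
                                (xor-same (x i))))
    (λ A′x≡0 → kernel-from-Y λ i Zi →
                 xor≡false⇒≡ (trans (sym (A′-on-Z x Zi)) (A′x≡0 i Zi)))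

  bicycle-kernel : ∀ v → IsZero (A′ ·v v) ⇔ Bicycle B v
  bicycle-kernel v = mk⇔ bicycle kernel
    where
    open ≡-Reasoning
    -- An element of ker B is A′ applied to its part outside Z, and A′ is symmetric.
    bicycle : IsZero (A′ ·v v) → Bicycle B v
    bicycle A′v≡0 = from kernel⇔ (λ i _ → A′v≡0 i) , λ u Bu≡0 → begin
      ⟨ u , v ⟩                ≡⟨ ⟨⟩-congˡ (kernel-decomposition Bu≡0) v ⟩
      ⟨ comb u , v ⟩           ≡⟨ ⟨⟩-self-adjoint A′-sym (u ↾ ∁ Z) v ⟩
      ⟨ u ↾ ∁ Z , A′ ·v v ⟩    ≡⟨ ⟨⟩-zeroʳ (u ↾ ∁ Z) A′v≡0 ⟩
      false                    ∎
    -- For i ∉ Z, row i of A′ is column i, the fundamental circuit of i, which lies in ker B.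
    kernel : Bicycle B v → IsZero (A′ ·v v)
    kernel (Bv≡0 , v⊥) i with Z i in Zi
    ... | true  = to kernel⇔ Bv≡0 i Zi
    ... | false = begin
      (A′ ·v v) i         ≡⟨ ·v-as-inner A′-sym v i ⟩
      ⟨ col A′ i , v ⟩    ≡⟨ ⟨⟩-congˡ (A′-col i Zi) v ⟩
      ⟨ fund i , v ⟩      ≡⟨ v⊥ (fund i) (fund-kernel i) ⟩
      false               ∎

bicycle-space : {M : SetSystem n} {B : Matrix m n} → M ≋ ColumnMatroid B → ∀ v →
                (CS M v × CS⊥ M v) ⇔ Bicycle B v
bicycle-space {M = M} {B = B} M≋B v =
  mk⇔ (λ (cs , cs⊥) → to (CS⇔ker v) cs , λ u Bu≡0 → cs⊥ u (from (CS⇔ker u) Bu≡0))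
      (λ (Bv≡0 , v⊥) → from (CS⇔ker v) Bv≡0 , λ u cs → v⊥ u (to (CS⇔ker u) cs))
  where
  CS⇔ker : ∀ u → CS M u ⇔ IsZero (B ·v u)
  CS⇔ker u = ⇔.trans (CS-≋ M≋B u) (cycle-space-is-kernel B u)

corollary3 : (n : ℕ) (M : SetSystem n) → IsBinaryMatroid M →
    (Z : Subset n) → M Z →
    (G : Graph n) → 𝓜G G ≋ (M * Z) →
    IsBicycleMatroidOf M (ColumnMatroid (adj+V G))
corollary3 n M (m , B , M≋B) Z Z∈M G G≋M*Z =
  (n , adj+V G , λ _ → ⇔.refl) ,
  λ v → ⇔.trans (cycle-space-is-kernel (adj+V G) v)
                (⇔.trans (bicycle-kernel v) (⇔.sym (bicycle-space M≋B v)))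
  where
  open FundamentalGraph (to (M≋B Z) Z∈M) G (λ X → ⇔.trans (G≋M*Z X) (M≋B (X ⊕ Z)))
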